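{- Let $n\ge4$ and let $\Gamma$ be a simple connected graph on vertex set $\{2,\dots,n\}$. Then the projection $\tilde\pi_\Gamma$ does not contract all top-dimensional cones of $\mathcal{M}_{0,n}^{\mathrm{rad}}$: there exists an $(n-3)$-dimensional cone of $\mathcal{M}_{0,n}^{\mathrm{rad}}$ whose image under $\tilde\pi_\Gamma$ is $(n-3)$-dimensional.
   Context: Rational $n$-marked tropical curves: metric trees with ends labeled $1,\dots,n$, bounded edges of positive length, vertices of valence $\ge3$; $\mathcal{M}_{0,n}^{\mathrm{trop}}$ is their moduli cone complex, of pure dimension $n-3$, embedded in $Q_n=\mathbb{R}^{\binom n2}/\Phi(\mathbb{R}^n)$, $\Phi(x)=(x_i+x_j)_{i<j}$, via $C\mapsto(\mathrm{dist}(i,j))_{i<j}$ ($\mathrm{dist}(i,j)$ = total bounded-edge length between ends $i,j$). A curve with one bounded edge splitting $[n]=I\sqcup I^c$, $1\notin I$, gives the ray $\rho_I$. The root vertex $v_0$ is the vertex carrying end $1$; a radially aligned combinatorial type is a combinatorial type together with the weak ordering of its vertices by distance from $v_0$, and $\mathcal{M}_{0,n}^{\mathrm{rad}}$ is the refinement of $\mathcal{M}_{0,n}^{\mathrm{trop}}$ whose cones correspond to radially aligned combinatorial types. $\Gamma$-stability: a non-root vertex with $d$ bounded edges and end set $I$ is $\Gamma$-stable if $d>2$, or $d=2$ and $I\ne\emptyset$, or $d=1$ and some edge of $\Gamma$ joins two elements of $I$. A ray $\rho_I$ is $\Gamma$-unstable iff no edge of $\Gamma$ joins two elements of $I$. $U\subseteq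 Q_n$ is the span of the $\Gamma$-unstable rays and $\tilde\pi_\Gamma:Q_n\to Q_n/U$ is the quotient map.
   Formalization: The space $Q_n$, the span U of the Γ-unstable rays and the coefficients of linear combinations of the cone generators are taken over ℚ instead of ℝ. -}

module Defs where

open import Data.Nat as ℕ using (ℕ; zero; suc; _∸_; _≤ᵇ_)
open import Data.Fin using (Fin; zero; suc; toℕ; _≟_)
open import Data.Fin.Subset using (Subset; _∈_; ∣_∣)
open import Data.Rational using (ℚ; 0ℚ; 1ℚ; _+_; _*_; _-_)
open import Data.Bool using (Bool; true; false; if_then_else_; _∧_; _∨_; _xor_)
open import Data.List using (List; []; _∷_; _++_; map; upTo; allFin; foldr)
open import Data.List.Relation.Binary.Permutation.Propositional using (_↭_)
open import Data.List.Relation.Unary.All using (All)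
open import Data.Product using (Σ; ∃; _×_; _,_)
open import Data.Unit using (⊤)
open import Data.Vec using (lookup)
open import Relation.Nullary using (¬_; does)
open import Relation.Binary.PropositionalEquality using (_≡_)

-- Conventions: n = suc m.  Ends of a curve are Fin (suc m); end "1" is 'zero',
-- end "k+2" is 'suc k' for k : Fin m.  The graph Γ lives on Fin m, vertex k
-- standing for the label k+2 (so Γ is on {2,…,n}).

record SimpleGraph (m : ℕ) : Set₁ where
  field
    Adj    : Fin m → Fin m → Set
    sym    : ∀ {u v} → Adj u v → Adj v u
    irrefl : ∀ v → ¬ Adj v v

module _ {m : ℕ} (G : SimpleGraph m) where
  open SimpleGraph G

  data Reach : Fin m → Fin m → Set where
    here  : ∀ {u} → Reach u u
    there : ∀ {u w v} → Adj u w → Reach w v → Reach u v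

  Connected : Set
  Connected = ∀ u v → Reach u v

  -- the ray ρ_I (I ⊆ {2,…,n}, encoded as Subset m) is Γ-unstable
  Unstable : Subset m → Set
  Unstable I = ∀ u v → u ∈ I → v ∈ I → ¬ Adj u v

sumℚ : List ℚ → ℚ
sumℚ = foldr _+_ 0ℚ

Σℚ : (k : ℕ) → (Fin k → ℚ) → ℚ
Σℚ k f = sumℚ (map f (allFin k))

-- Q_n (over ℚ): vectors v i j, only the entries with i < j are relevant.

Vecₙ : ℕ → Set
Vecₙ m = Fin (suc m) → Fin (suc m) → ℚ

memb : ∀ {m} → Subset m → Fin (suc m) → Bool
memb I zero    = false
memb I (suc v) = lookup I v

-- I (with 1 ∉ I) gives a ray: both sides of the split have ≥ 2 ends
IsRay : ∀ {m} → Subset m → Set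
IsRay {m} I = 2 ℕ.≤ ∣ I ∣ × 2 ℕ.≤ suc m ∸ ∣ I ∣

-- the point of ρ_I: the curve with one bounded edge of length 1 splitting I | I^c
rayVec : ∀ {m} → Subset m → Vecₙ m
rayVec I i j = if memb I i xor memb I j then 1ℚ else 0ℚ

-- v lies in U + Φ(ℚⁿ), i.e. its class in Q_n / U is zero
InUΦ : ∀ {m} → SimpleGraph m → Vecₙ m → Set
InUΦ {m} G v =
  Σ (List (Subset m × ℚ)) λ cs →
    All (λ p → IsRay (Data.Product.proj₁ p) × Unstable G (Data.Product.proj₁ p)) cs ×
    Σ (Fin (suc m) → ℚ) λ b →
      ∀ i j → toℕ i ℕ.< toℕ j →
        v i j ≡ (sumℚ (map (λ p → Data.Product.proj₂ p * rayVec (Data.Product.proj₁ p) i j) cs) + b i) + b j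

-- A trivalent tree hanging from the root vertex v₀ (which carries end 1);
-- each non-root vertex is a 'node' carrying its rank in the radial order.
-- Leaves are the ends 2,…,n (attached to the vertex of the parent node).

data RTree (m : ℕ) : Set where
  leaf : Fin m → RTree m
  node : ℕ → RTree m → RTree m → RTree m

leaves : ∀ {m} → RTree m → List (Fin m)
leaves (leaf v)     = v ∷ []
leaves (node _ l r) = leaves l ++ leaves r

labels : ∀ {m} → RTree m → List ℕ
labels (leaf _)     = []
labels (node k l r) = k ∷ labels l ++ labels r

Ranked : ∀ {m} → ℕ → RTree m → Set
Ranked p (leaf _)     = ⊤
Ranked p (node k l r) = p ℕ.< k × Ranked k l × Ranked k r

-- the root vertex has rank 0; the n-3 = m-2 non-root vertices have the
-- pairwise distinct ranks 1,…,n-3 (a strict total order by distance to v₀)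
record TopRadType (m : ℕ) : Set where
  field
    left right : RTree m
    rankedL    : Ranked 0 left
    rankedR    : Ranked 0 right
    leavesPerm : leaves left ++ leaves right ↭ allFin m
    labelsPerm : labels left ++ labels right ↭ map suc (upTo (m ∸ 2))

  tree : RTree m
  tree = node 0 left right

inT : ∀ {m} → RTree m → Fin (suc m) → Bool
inT (leaf v)     zero    = false
inT (leaf v)     (suc w) = does (v ≟ w)
inT (node _ l r) i       = inT l i ∨ inT r i

-- metric realisation: ρ k = distance from v₀ of the vertex of rank k
module Metric {m : ℕ} (ρ : ℕ → ℚ) where
  -- distance from v₀ of the vertex carrying end i (p = rank of parent vertex)
  rad : ℕ → RTree m → Fin (suc m) → ℚ
  rad p (leaf _)     i = ρ p
  rad p (node k l r) i =
    if inT l i then rad k l i else if inT r i then rad k r i else ρ k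

  -- distance from v₀ of the meet of the paths from v₀ to ends i and j
  meet : ℕ → RTree m → Fin (suc m) → Fin (suc m) → ℚ
  meet p (leaf _)     i j = ρ p
  meet p (node k l r) i j =
    if inT l i ∧ inT l j then meet k l i j
    else if inT r i ∧ inT r j then meet k r i j else ρ k

  dist : RTree m → Vecₙ m
  dist t i j = (rad 0 t i + rad 0 t j) - ((1ℚ + 1ℚ) * meet 0 t i j)

-- radius profile of the k-th ray generator of the simplicial cone:
-- all vertices of rank ≥ k are moved one unit further from v₀
step : ℕ → ℕ → ℚ
step k l = if k ≤ᵇ l then 1ℚ else 0ℚ

-- the n-3 generators of the (closed) cone of the type T in Q_n
gen : ∀ {m} → TopRadType m → Fin (m ∸ 2) → Vecₙ m
gen T k = Metric.dist (step (suc (toℕ k))) (TopRadType.tree T)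

-- the image of the cone of T under π̃_Γ is (n-3)-dimensional:
-- the images of its n-3 generators in Q_n/U are linearly independent
ImageFullDim : ∀ {m} → SimpleGraph m → TopRadType m → Set
ImageFullDim {m} G T =
  ∀ (c : Fin (m ∸ 2) → ℚ) →
    InUΦ G (λ i j → Σℚ (m ∸ 2) (λ k → c k * gen T k i j)) →
    ∀ k → c k ≡ 0ℚ

module Submission where

-- Order the vertices of Γ as x₁, …, x_m (m = n−1) so that, read backwards, the order
-- grows a connected subgraph from an edge (a growth order: each xᵢ is adjacent to a later
-- vertex).  Take the caterpillar: end 1 and x₁ at the root, xᵢ on the spine vertex of rank i−1,
-- the last two ends on the last spine vertex.  The k-th generator of its cone moves every
-- vertex of rank ≥ k+1 one unit outwards, so it is the split vector of the cut "rank ≥ k+1".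
-- For each level k the growth order supplies a path b – d – c in Γ with b of rank k and c, d
-- of higher rank; the four-point functional f(1,b) + f(c,d) − f(1,c) − f(b,d) vanishes on Φ and
-- on every Γ-unstable ray, is −2 on the k-th generator and 0 on the lower ones.  Hence the images
-- of the generators are independent, by downward induction on k.

open import Defs
open import Data.Nat as ℕ using (ℕ; zero; suc; _∸_; _≤ᵇ_; _≤_; s≤s; z≤n)
import Data.Nat.Properties as ℕP
open import Data.Fin using (Fin; zero; suc; toℕ; _≟_)
import Data.Fin.Properties as FinP
open import Data.Fin.Induction using (>-wellFounded)
open import Data.Fin.Subset using (Subset)
open import Data.Vec using (lookup)
import Data.Vec.Properties as VecP
open import Data.Rational using (ℚ; 0ℚ; 1ℚ; _+_; _*_; _-_; NonZero; 1/_)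
import Data.Rational.Properties as ℚP
open import Data.Rational.Solver using (module +-*-Solver)
open import Data.Bool using (Bool; true; false; if_then_else_; _∧_; _xor_)
import Data.Bool.Properties as BoolP
open import Data.List using (List; []; _∷_; _++_; map; length; allFin; upTo; applyUpTo)
import Data.List.Properties as ListP
open import Data.List.Membership.Propositional using (_∈_; _∉_)
open import Data.List.Membership.Propositional.Properties
  using (∈-∃++; ∈-++⁻; ∈-++⁺ˡ; ∈-++⁺ʳ; ∈-allFin; ∈-tabulate⁺)
open import Data.List.Relation.Unary.Any using (here; there)
import Data.List.Relation.Unary.All as All
open import Data.List.Relation.Unary.All using (All; []; _∷_)
open import Data.List.Relation.Unary.AllPairs using (_∷_)
open import Data.List.Relation.Unary.Unique.Propositional using (Unique)
import Data.List.Relation.Unary.Unique.Propositional.Properties as UniqueP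
open import Data.List.Relation.Binary.Permutation.Propositional
  using (_↭_; ↭-sym; ↭-trans; ↭-reflexive; ↭⇒↭ₛ; prep)
open import Data.List.Relation.Binary.Permutation.Propositional.Properties
  using (shift; ↭-length; ∈-resp-↭; ++⁺ˡ)
import Data.List.Relation.Binary.Permutation.Setoid.Properties as PermSetoidP
open import Data.Product using (Σ; ∃; _×_; _,_; proj₁; proj₂)
open import Data.Sum using (inj₁; inj₂)
open import Data.Unit using (tt)
open import Data.Empty using (⊥; ⊥-elim)
open import Function using (_∘_)
import Induction.WellFounded as WF
open import Level using (0ℓ)
open import Relation.Binary.Definitions using (tri<; tri≈; tri>)
open import Relation.Nullary using (¬_; does; yes; no)
open import Relation.Nullary.Decidable using (dec-true; dec-false)
open import Relation.Binary.PropositionalEquality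

open +-*-Solver

ind : Bool → ℚ
ind x = if x then 1ℚ else 0ℚ

cancel-nonzero : ∀ q r .{{_ : NonZero r}} → q * r ≡ 0ℚ → q ≡ 0ℚ
cancel-nonzero q r qr≡0 = begin
  q               ≡⟨ sym (ℚP.*-identityʳ q) ⟩
  q * 1ℚ          ≡⟨ cong (q *_) (sym (ℚP.*-inverseʳ r)) ⟩
  q * (r * 1/ r)  ≡⟨ sym (ℚP.*-assoc q r (1/ r)) ⟩
  (q * r) * 1/ r  ≡⟨ cong (_* 1/ r) qr≡0 ⟩
  0ℚ * 1/ r       ≡⟨ ℚP.*-zeroˡ (1/ r) ⟩
  0ℚ              ∎
  where open ≡-Reasoning

sum-vanishes : ∀ {A : Set} {P : A → Set} (f : A → ℚ) {xs : List A} →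
  All P xs → (∀ x → P x → f x ≡ 0ℚ) → sumℚ (map f xs) ≡ 0ℚ
sum-vanishes f []         _ = refl
sum-vanishes f (px ∷ pxs) h rewrite h _ px | sum-vanishes f pxs h = refl

Σℚ-suc : ∀ N (f : Fin (suc N) → ℚ) → Σℚ (suc N) f ≡ f zero + Σℚ N (λ j → f (suc j))
Σℚ-suc N f = cong (λ xs → f zero + sumℚ xs)
  (trans (ListP.map-tabulate suc f) (sym (ListP.map-tabulate (λ j → j) (λ j → f (suc j)))))

Σℚ-zero : ∀ N (f : Fin N → ℚ) → (∀ j → f j ≡ 0ℚ) → Σℚ N f ≡ 0ℚ
Σℚ-zero zero    f h = refl
Σℚ-zero (suc N) f h = begin
  Σℚ (suc N) f                      ≡⟨ Σℚ-suc N f ⟩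
  f zero + Σℚ N (λ j → f (suc j))   ≡⟨ cong₂ _+_ (h zero) (Σℚ-zero N _ (λ j → h (suc j))) ⟩
  0ℚ                                ∎
  where open ≡-Reasoning

Σℚ-single : ∀ N (f : Fin N → ℚ) k → (∀ j → j ≢ k → f j ≡ 0ℚ) → Σℚ N f ≡ f k
Σℚ-single (suc N) f zero h = begin
  Σℚ (suc N) f                      ≡⟨ Σℚ-suc N f ⟩
  f zero + Σℚ N (λ j → f (suc j))   ≡⟨ cong (f zero +_) (Σℚ-zero N _ (λ j → h (suc j) λ ())) ⟩
  f zero + 0ℚ                       ≡⟨ ℚP.+-identityʳ (f zero) ⟩
  f zero                            ∎
  where open ≡-Reasoning
Σℚ-single (suc N) f (suc k) h = begin
  Σℚ (suc N) f                      ≡⟨ Σℚ-suc N f ⟩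
  f zero + Σℚ N (λ j → f (suc j))   ≡⟨ cong₂ _+_ (h zero λ ()) (Σℚ-single N _ k λ j j≢k → h (suc j) (j≢k ∘ FinP.suc-injective)) ⟩
  0ℚ + f (suc k)                    ≡⟨ ℚP.+-identityˡ (f (suc k)) ⟩
  f (suc k)                         ∎
  where open ≡-Reasoning

downward-induction : ∀ {N} (P : Fin N → Set) → (∀ k → (∀ {j} → toℕ k ℕ.< toℕ j → P j) → P k) → ∀ k → P k
downward-induction P step = WF.All.wfRec >-wellFounded 0ℓ P step

side : ∀ {m} → (Fin m → Bool) → Fin (suc m) → Bool
side σ zero    = false
side σ (suc u) = σ u

splitVec : ∀ {m} → (Fin m → Bool) → Vecₙ m
splitVec σ i j = ind (side σ i xor side σ j)

fourPoint : ∀ {m} → Fin m → Fin m → Fin m → Vecₙ m → ℚ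
fourPoint b c d f = ((f zero (suc b) + f (suc c) (suc d)) - f zero (suc c)) - f (suc b) (suc d)

-- Its value on a split vector, in terms of the sides β, γ, δ of b, c, d.
cutValue : Bool → Bool → Bool → ℚ
cutValue β γ δ = ((ind β + ind (γ xor δ)) - ind γ) - ind (β xor δ)

cutValue-vanishes : ∀ β γ δ → (γ ≡ true → δ ≡ true → ⊥) → (β ≡ true → δ ≡ true → ⊥) →
  cutValue β γ δ ≡ 0ℚ
cutValue-vanishes false false false _ _ = refl
cutValue-vanishes false true  false _ _ = refl
cutValue-vanishes true  false false _ _ = refl
cutValue-vanishes true  true  false _ _ = refl
cutValue-vanishes false false true  _ _ = refl
cutValue-vanishes false true  true  cd _ = ⊥-elim (cd refl refl)
cutValue-vanishes true  _     true  _ bd = ⊥-elim (bd refl refl)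

fourPoint-sum : ∀ {m} {A : Set} (b c d : Fin m) (w : A → ℚ) (f : A → Vecₙ m) (xs : List A) →
  fourPoint b c d (λ i j → sumℚ (map (λ x → w x * f x i j) xs))
    ≡ sumℚ (map (λ x → w x * fourPoint b c d (f x)) xs)
fourPoint-sum b c d w f []       = refl
fourPoint-sum b c d w f (x ∷ xs) =
  trans (solve 9 (λ q f₁ f₂ f₃ f₄ s₁ s₂ s₃ s₄ →
           (((q :* f₁ :+ s₁) :+ (q :* f₂ :+ s₂)) :- (q :* f₃ :+ s₃)) :- (q :* f₄ :+ s₄)
           := q :* (((f₁ :+ f₂) :- f₃) :- f₄) :+ (((s₁ :+ s₂) :- s₃) :- s₄)) refl
           (w x) (f x zero (suc b)) (f x (suc c) (suc d)) (f x zero (suc c)) (f x (suc b) (suc d))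
           (S zero (suc b)) (S (suc c) (suc d)) (S zero (suc c)) (S (suc b) (suc d)))
    (cong (w x * fourPoint b c d (f x) +_) (fourPoint-sum b c d w f xs))
  where
  S : Vecₙ _
  S i j = sumℚ (map (λ x → w x * f x i j) xs)

module _ {m : ℕ} (G : SimpleGraph m) where
  open SimpleGraph G using (Adj; irrefl)

  fourPoint-unstable : ∀ {I : Subset m} {b c d} → Unstable G I → Adj b d → Adj c d →
    fourPoint b c d (rayVec I) ≡ 0ℚ
  fourPoint-unstable {I} {b} {c} {d} unstable bd cd =
    cutValue-vanishes (lookup I b) (lookup I c) (lookup I d)
      (λ c∈I d∈I → unstable c d (VecP.lookup⇒[]= c I c∈I) (VecP.lookup⇒[]= d I d∈I) cd)
      (λ b∈I d∈I → unstable b d (VecP.lookup⇒[]= b I b∈I) (VecP.lookup⇒[]= d I d∈I) bd)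

  -- The four-point functional of a path b – d – c of Γ annihilates U + Φ(ℚⁿ).  Since InUΦ only
  -- constrains the entries (i,j) with i < j, v is assumed symmetric on the ends 2,…,n.
  fourPoint-UΦ : ∀ {v : Vecₙ m} {b c d} → (∀ u w → v (suc u) (suc w) ≡ v (suc w) (suc u)) →
    InUΦ G v → Adj b d → Adj c d → fourPoint b c d v ≡ 0ℚ
  fourPoint-UΦ {v} {b} {c} {d} v-sym (cs , rays , β , decomp) bd cd = begin
    -- v agrees with R on the four entries (all off the diagonal, as Γ has no loops)
    fourPoint b c d v
      ≡⟨ cong₂ _-_ (cong₂ _-_ (cong₂ _+_ (agree-root b) (agree c d (adj⇒≢ cd))) (agree-root c))
                   (agree b d (adj⇒≢ bd)) ⟩
    -- the Φ(β) part cancels: each of 1, b, c, d occurs once with each sign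
    fourPoint b c d R
      ≡⟨ solve 8 (λ s₁ s₂ s₃ s₄ z x y w →
           ((((s₁ :+ z) :+ x) :+ ((s₂ :+ y) :+ w)) :- ((s₃ :+ z) :+ y)) :- ((s₄ :+ x) :+ w)
           := ((s₁ :+ s₂) :- s₃) :- s₄) refl
           (S zero (suc b)) (S (suc c) (suc d)) (S zero (suc c)) (S (suc b) (suc d))
           (β zero) (β (suc b)) (β (suc c)) (β (suc d)) ⟩
    -- by linearity, and each ray is Γ-unstable
    fourPoint b c d S
      ≡⟨ fourPoint-sum b c d proj₂ (λ p → rayVec (proj₁ p)) cs ⟩
    sumℚ (map (λ p → proj₂ p * fourPoint b c d (rayVec (proj₁ p))) cs)
      ≡⟨ sum-vanishes _ rays (λ p ray → trans (cong (proj₂ p *_) (fourPoint-unstable (proj₂ ray) bd cd))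
                                              (ℚP.*-zeroʳ (proj₂ p))) ⟩
    0ℚ ∎
    where
    open ≡-Reasoning

    S R : Vecₙ m
    S i j = sumℚ (map (λ p → proj₂ p * rayVec (proj₁ p) i j) cs)
    R i j = (S i j + β i) + β j

    R-sym : ∀ u w → R (suc u) (suc w) ≡ R (suc w) (suc u)
    R-sym u w = trans
      (cong (λ s → (s + β (suc u)) + β (suc w)) (cong sumℚ (ListP.map-cong
        (λ p → cong (λ x → proj₂ p * ind x) (BoolP.xor-comm (lookup (proj₁ p) u) (lookup (proj₁ p) w))) cs)))
      (solve 3 (λ s x y → (s :+ x) :+ y := (s :+ y) :+ x) refl (S (suc w) (suc u)) (β (suc u)) (β (suc w)))

    agree-root : ∀ u → v zero (suc u) ≡ R zero (suc u)
    agree-root u = decomp zero (suc u) (s≤s z≤n)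

    agree : ∀ u w → u ≢ w → v (suc u) (suc w) ≡ R (suc u) (suc w)
    agree u w u≢w with ℕP.<-cmp (toℕ u) (toℕ w)
    ... | tri< u<w _ _ = decomp (suc u) (suc w) (s≤s u<w)
    ... | tri≈ _ u≡w _ = ⊥-elim (u≢w (FinP.toℕ-injective u≡w))
    ... | tri> _ _ u>w = trans (v-sym u w) (trans (decomp (suc w) (suc u) (s≤s u>w)) (sym (R-sym u w)))

    adj⇒≢ : ∀ {x y} → Adj x y → x ≢ y
    adj⇒≢ {x} a refl = irrefl x a

cut : ∀ {m} → (Fin m → ℕ) → ℕ → Fin m → Bool
cut rk K u = K ≤ᵇ rk u

cut-true : ∀ {m} (rk : Fin m → ℕ) {K} u → K ℕ.≤ rk u → cut rk K u ≡ true
cut-true rk {K} u = dec-true (K ℕ.≤? rk u)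

cut-false : ∀ {m} (rk : Fin m → ℕ) {K} u → ¬ K ℕ.≤ rk u → cut rk K u ≡ false
cut-false rk {K} u = dec-false (K ℕ.≤? rk u)

GeneratorsAreCuts : ∀ {m} → TopRadType m → (Fin m → ℕ) → Set
GeneratorsAreCuts T rk = ∀ k i u → gen T k i (suc u) ≡ splitVec (cut rk (suc (toℕ k))) i (suc u)

-- A witness for level t: a path b – d – c of Γ with b of rank exactly t and c, d of rank > t.
-- Its four-point functional sees the generator at level t but none of those below it.
record Witness {m : ℕ} (G : SimpleGraph m) (rk : Fin m → ℕ) (t : ℕ) : Set where
  field
    b c d   : Fin m
    rank-b  : rk b ≡ t
    rank-c  : t ℕ.< rk c
    rank-d  : t ℕ.< rk d
    edge-bd : SimpleGraph.Adj G b d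
    edge-cd : SimpleGraph.Adj G c d

-- The
-- witnesses make the system triangular, so the coefficients vanish by downward induction.
independence : ∀ {m} (G : SimpleGraph m) (T : TopRadType m) (rk : Fin m → ℕ) →
  GeneratorsAreCuts T rk → (∀ (k : Fin (m ∸ 2)) → Witness G rk (toℕ k)) → ImageFullDim G T
independence {m} G T rk cuts witness coeff inUΦ =
  downward-induction (λ k → coeff k ≡ 0ℚ) level-vanishes
  where
  N : ℕ
  N = m ∸ 2

  σ : Fin N → Fin m → Bool
  σ j = cut rk (suc (toℕ j))

  v : Vecₙ m
  v i j = Σℚ N (λ k → coeff k * gen T k i j)

  v-sym : ∀ u w → v (suc u) (suc w) ≡ v (suc w) (suc u)
  v-sym u w = cong sumℚ (ListP.map-cong (λ k → cong (coeff k *_) (begin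
    gen T k (suc u) (suc w)               ≡⟨ cuts k (suc u) w ⟩
    ind (σ k u xor σ k w)                 ≡⟨ cong ind (BoolP.xor-comm (σ k u) (σ k w)) ⟩
    ind (σ k w xor σ k u)                 ≡⟨ sym (cuts k (suc w) u) ⟩
    gen T k (suc w) (suc u)               ∎)) (allFin N))
    where open ≡-Reasoning

  -- the four-point functional of b, c, d evaluated on v; on each generator it is a cutValue,
  -- since fourPoint of a split vector is definitionally cutValue of the three sides
  fourPoint-v : ∀ b c d → fourPoint b c d v ≡ Σℚ N (λ j → coeff j * cutValue (σ j b) (σ j c) (σ j d))
  fourPoint-v b c d = trans (fourPoint-sum b c d coeff (gen T) (allFin N))
    (cong sumℚ (ListP.map-cong (λ j → cong (coeff j *_)
      (cong₂ _-_ (cong₂ _-_ (cong₂ _+_ (cuts j zero b) (cuts j (suc c) d)) (cuts j zero c)) (cuts j (suc b) d)))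
      (allFin N)))

  -- the k-th coefficient vanishes once all higher ones do: the witness of level k gives
  -- 0 = fourPoint v = coeff k · cutValue false true true, and cutValue false true true = −2
  level-vanishes : ∀ k → (∀ {j} → toℕ k ℕ.< toℕ j → coeff j ≡ 0ℚ) → coeff k ≡ 0ℚ
  level-vanishes k higher = cancel-nonzero (coeff k) (cutValue false true true) (begin
    coeff k * cutValue false true true   ≡⟨ cong (coeff k *_) (sym at-level) ⟩
    term k                               ≡⟨ sym (Σℚ-single N term k others) ⟩
    Σℚ N term                            ≡⟨ sym (fourPoint-v b c d) ⟩
    fourPoint b c d v                    ≡⟨ fourPoint-UΦ G v-sym inUΦ edge-bd edge-cd ⟩
    0ℚ                                   ∎)
    where
    open ≡-Reasoning
    open Witness (witness k)

    term : Fin N → ℚ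
    term j = coeff j * cutValue (σ j b) (σ j c) (σ j d)

    -- at level k, b lies below the cut and c, d above it
    at-level : cutValue (σ k b) (σ k c) (σ k d) ≡ cutValue false true true
    at-level rewrite cut-false rk b (λ k<rk-b → ℕP.<-irrefl (sym rank-b) k<rk-b)
                   | cut-true rk c rank-c
                   | cut-true rk d rank-d = refl

    -- below level k all of b, c, d lie above the cut; above level k the coefficients vanish
    others : ∀ j → j ≢ k → term j ≡ 0ℚ
    others j j≢k with ℕP.<-cmp (toℕ j) (toℕ k)
    ... | tri< j<k _ _ rewrite cut-true rk b (ℕP.≤-trans j<k (ℕP.≤-reflexive (sym rank-b)))
                             | cut-true rk c (ℕP.<-trans j<k rank-c)
                             | cut-true rk d (ℕP.<-trans j<k rank-d) = ℚP.*-zeroʳ (coeff j)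
    ... | tri≈ _ j≡k _ = ⊥-elim (j≢k (FinP.toℕ-injective j≡k))
    ... | tri> _ _ j>k rewrite higher j>k = ℚP.*-zeroˡ (cutValue (σ j b) (σ j c) (σ j d))

inT-root : ∀ {m} (t : RTree m) → inT t zero ≡ false
inT-root (leaf _)     = refl
inT-root (node _ l r) rewrite inT-root l | inT-root r = refl

applyUpTo-cong : ∀ {f g : ℕ → ℕ} n → (∀ i → f i ≡ g i) → applyUpTo f n ≡ applyUpTo g n
applyUpTo-cong zero    _ = refl
applyUpTo-cong (suc n) h = cong₂ _∷_ (h 0) (applyUpTo-cong n (λ i → h (suc i)))

inT-leaf : ∀ {m} (t : RTree m) {v} → v ∈ leaves t → inT t (suc v) ≡ true
inT-leaf (leaf u)     {v} (here refl) = dec-true (v ≟ v) refl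
inT-leaf (node _ l r) v∈ with ∈-++⁻ (leaves l) v∈
... | inj₁ v∈l rewrite inT-leaf l v∈l = refl
... | inj₂ v∈r rewrite inT-leaf r v∈r = BoolP.∨-zeroʳ (inT l _)

inT-nonleaf : ∀ {m} (t : RTree m) {v} → v ∉ leaves t → inT t (suc v) ≡ false
inT-nonleaf (leaf u)     {v} v∉ = dec-false (u ≟ v) (λ u≡v → v∉ (here (sym u≡v)))
inT-nonleaf (node _ l r) v∉
  rewrite inT-nonleaf l (v∉ ∘ ∈-++⁺ˡ) | inT-nonleaf r (v∉ ∘ ∈-++⁺ʳ (leaves l)) = refl

≤ᵇ-∧-below : ∀ K {a b} → a ℕ.≤ b → ((K ≤ᵇ a) ∧ (K ≤ᵇ b)) ≡ (K ≤ᵇ a)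
≤ᵇ-∧-below K {a} {b} a≤b with K ℕ.≤? a
... | yes K≤a rewrite dec-true (K ℕ.≤? a) K≤a | dec-true (K ℕ.≤? b) (ℕP.≤-trans K≤a a≤b) = refl
... | no  K≰a rewrite dec-false (K ℕ.≤? a) K≰a = refl

module _ {m : ℕ} where

  caterpillar : ℕ → Fin m → Fin m → List (Fin m) → RTree m
  caterpillar r u w []       = node r (leaf u) (leaf w)
  caterpillar r u w (z ∷ zs) = node r (leaf u) (caterpillar (suc r) w z zs)

  spineRank : ℕ → Fin m → Fin m → List (Fin m) → Fin m → ℕ
  spineRank r u w []       v = r
  spineRank r u w (z ∷ zs) v = if does (u ≟ v) then r else spineRank (suc r) w z zs v

  leaves-caterpillar : ∀ r u w zs → leaves (caterpillar r u w zs) ≡ u ∷ w ∷ zs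
  leaves-caterpillar r u w []       = refl
  leaves-caterpillar r u w (z ∷ zs) = cong (u ∷_) (leaves-caterpillar (suc r) w z zs)

  labels-caterpillar : ∀ r u w zs → labels (caterpillar r u w zs) ≡ applyUpTo (r ℕ.+_) (suc (length zs))
  labels-caterpillar r u w []       = cong (_∷ []) (sym (ℕP.+-identityʳ r))
  labels-caterpillar r u w (z ∷ zs) = cong₂ _∷_ (sym (ℕP.+-identityʳ r))
    (trans (labels-caterpillar (suc r) w z zs) (applyUpTo-cong (suc (length zs)) (λ i → sym (ℕP.+-suc r i))))

  ranked-caterpillar : ∀ p r u w zs → p ℕ.< r → Ranked p (caterpillar r u w zs)
  ranked-caterpillar p r u w []       p<r = p<r , tt , tt
  ranked-caterpillar p r u w (z ∷ zs) p<r = p<r , tt , ranked-caterpillar r (suc r) w z zs ℕP.≤-refl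

  spineRank-≥ : ∀ r u w zs v → r ℕ.≤ spineRank r u w zs v
  spineRank-≥ r u w []       v = ℕP.≤-refl
  spineRank-≥ r u w (z ∷ zs) v with does (u ≟ v)
  ... | true  = ℕP.≤-refl
  ... | false = ℕP.<⇒≤ (spineRank-≥ (suc r) w z zs v)

  spineRank-head : ∀ r u w zs → spineRank r u w zs u ≡ r
  spineRank-head r u w []       = refl
  spineRank-head r u w (z ∷ zs) with u ≟ u
  ... | yes _  = refl
  ... | no u≢u = ⊥-elim (u≢u refl)

  spineRank-tail : ∀ r u w z zs v → u ≢ v → spineRank r u w (z ∷ zs) v ≡ spineRank (suc r) w z zs v
  spineRank-tail r u w z zs v u≢v with u ≟ v
  ... | yes u≡v = ⊥-elim (u≢v u≡v)
  ... | no _    = refl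

  spineRank-tail-∈ : ∀ r (u w z : Fin m) zs {x} → Unique (u ∷ w ∷ z ∷ zs) → x ∈ w ∷ z ∷ zs →
    spineRank r u w (z ∷ zs) x ≡ spineRank (suc r) w z zs x
  spineRank-tail-∈ r u w z zs (u≢rest ∷ _) x∈ = spineRank-tail r u w z zs _ (All.lookup u≢rest x∈)

  inT-caterpillar : ∀ r u w zs {v} → v ∈ u ∷ w ∷ zs → inT (caterpillar r u w zs) (suc v) ≡ true
  inT-caterpillar r u w zs v∈ = inT-leaf (caterpillar r u w zs) (subst (_ ∈_) (sym (leaves-caterpillar r u w zs)) v∈)

  inT-caterpillar-∉ : ∀ r u w zs {v} → v ∉ u ∷ w ∷ zs → inT (caterpillar r u w zs) (suc v) ≡ false
  inT-caterpillar-∉ r u w zs v∉ = inT-nonleaf (caterpillar r u w zs) (v∉ ∘ subst (_ ∈_) (leaves-caterpillar r u w zs))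

  rad-caterpillar-root : ∀ (ρ : ℕ → ℚ) p r u w zs → Metric.rad ρ p (caterpillar r u w zs) zero ≡ ρ r
  rad-caterpillar-root ρ p r u w []       = refl
  rad-caterpillar-root ρ p r u w (z ∷ zs) rewrite inT-root (caterpillar (suc r) w z zs) = refl

  meet-caterpillar-root : ∀ (ρ : ℕ → ℚ) p r u w zs j → Metric.meet ρ p (caterpillar r u w zs) zero j ≡ ρ r
  meet-caterpillar-root ρ p r u w []       j = refl
  meet-caterpillar-root ρ p r u w (z ∷ zs) j rewrite inT-root (caterpillar (suc r) w z zs) = refl

  rad-caterpillar : ∀ (ρ : ℕ → ℚ) p r u w zs {v} → v ∈ u ∷ w ∷ zs →
    Metric.rad ρ p (caterpillar r u w zs) (suc v) ≡ ρ (spineRank r u w zs v)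
  rad-caterpillar ρ p r u w [] {v} _ with does (u ≟ v) | does (w ≟ v)
  ... | true  | _     = refl
  ... | false | true  = refl
  ... | false | false = refl
  rad-caterpillar ρ p r u w (z ∷ zs) {v} v∈ with u ≟ v | v∈
  ... | yes _   | _         = refl
  ... | no u≢v  | here v≡u  = ⊥-elim (u≢v (sym v≡u))
  ... | no _    | there v∈′ rewrite inT-caterpillar (suc r) w z zs v∈′ = rad-caterpillar ρ r (suc r) w z zs v∈′

  -- Two ends of the caterpillar meet at the lower of their spine vertices; for the radius
  -- profile of level K this vertex is beyond the cut exactly when both ends are.
  meet-caterpillar : ∀ K p r u w zs {v v'} → Unique (u ∷ w ∷ zs) → v ∈ u ∷ w ∷ zs → v' ∈ u ∷ w ∷ zs →
    Metric.meet (step K) p (caterpillar r u w zs) (suc v) (suc v')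
      ≡ ind (cut (spineRank r u w zs) K v ∧ cut (spineRank r u w zs) K v')
  meet-caterpillar K p r u w [] {v} {v'} _ _ _
    with does (u ≟ v) ∧ does (u ≟ v') | does (w ≟ v) ∧ does (w ≟ v')
  ... | true  | _     = cong ind (sym (BoolP.∧-idem (K ≤ᵇ r)))
  ... | false | true  = cong ind (sym (BoolP.∧-idem (K ≤ᵇ r)))
  ... | false | false = cong ind (sym (BoolP.∧-idem (K ≤ᵇ r)))
  meet-caterpillar K p r u w (z ∷ zs) {v} {v'} (u≢rest ∷ unique) v∈ v'∈ with u ≟ v | u ≟ v'
  ... | yes refl | yes refl = cong ind (sym (BoolP.∧-idem (K ≤ᵇ r)))
  ... | yes refl | no _
    rewrite inT-caterpillar-∉ (suc r) w z zs {u} (UniqueP.Unique[x∷xs]⇒x∉xs (u≢rest ∷ unique)) =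
    cong ind (sym (≤ᵇ-∧-below K (ℕP.<⇒≤ (spineRank-≥ (suc r) w z zs v'))))
  ... | no _ | yes refl
    rewrite inT-caterpillar-∉ (suc r) w z zs {u} (UniqueP.Unique[x∷xs]⇒x∉xs (u≢rest ∷ unique))
          | BoolP.∧-zeroʳ (inT (caterpillar (suc r) w z zs) (suc v)) =
    cong ind (sym (trans (BoolP.∧-comm (K ≤ᵇ spineRank (suc r) w z zs v) (K ≤ᵇ r))
                         (≤ᵇ-∧-below K (ℕP.<⇒≤ (spineRank-≥ (suc r) w z zs v)))))
  ... | no u≢v | no u≢v' with v∈ | v'∈
  ...   | here v≡u  | _          = ⊥-elim (u≢v (sym v≡u))
  ...   | there _   | here v'≡u  = ⊥-elim (u≢v' (sym v'≡u))
  ...   | there v∈′ | there v'∈′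
    rewrite inT-caterpillar (suc r) w z zs v∈′ | inT-caterpillar (suc r) w z zs v'∈′ =
    meet-caterpillar K r (suc r) w z zs unique v∈′ v'∈′

-- For 0/1 radii, r(i) + r(j) − 2·r(meet) is the indicator of the ends lying on different sides.
ind-xor : ∀ a b → (ind a + ind b) - ((1ℚ + 1ℚ) * ind (a ∧ b)) ≡ ind (a xor b)
ind-xor true  true  = refl
ind-xor true  false = refl
ind-xor false true  = refl
ind-xor false false = refl

caterpillar-cuts : ∀ {m} K (u w : Fin m) zs → Unique (u ∷ w ∷ zs) → (∀ v → v ∈ u ∷ w ∷ zs) → ∀ i v →
  Metric.dist (step (suc K)) (caterpillar 0 u w zs) i (suc v)
    ≡ splitVec (cut (spineRank 0 u w zs) (suc K)) i (suc v)
caterpillar-cuts K u w zs unique every zero v =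
  trans (cong₂ (λ x y → x - ((1ℚ + 1ℚ) * y))
          (cong₂ _+_ (rad-caterpillar-root (step (suc K)) 0 0 u w zs) (rad-caterpillar (step (suc K)) 0 0 u w zs (every v)))
          (meet-caterpillar-root (step (suc K)) 0 0 u w zs (suc v)))
    (ind-xor false (cut (spineRank 0 u w zs) (suc K) v))
caterpillar-cuts K u w zs unique every (suc v′) v =
  trans (cong₂ (λ x y → x - ((1ℚ + 1ℚ) * y))
          (cong₂ _+_ (rad-caterpillar (step (suc K)) 0 0 u w zs (every v′)) (rad-caterpillar (step (suc K)) 0 0 u w zs (every v)))
          (meet-caterpillar (suc K) 0 0 u w zs unique (every v′) (every v)))
    (ind-xor (cut (spineRank 0 u w zs) (suc K) v′) (cut (spineRank 0 u w zs) (suc K) v))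

module _ {m : ℕ} {L : List (Fin m)} (perm : L ↭ allFin m) where

  listing-unique : Unique L
  listing-unique = PermSetoidP.Unique-resp-↭ (setoid (Fin m)) (↭⇒↭ₛ (↭-sym perm)) (UniqueP.allFin⁺ m)

  listing-complete : ∀ v → v ∈ L
  listing-complete v = ∈-resp-↭ (↭-sym perm) (∈-allFin v)

  listing-length : length L ≡ m
  listing-length = trans (↭-length perm) (ListP.length-tabulate (λ v → v))

unique-++-disjoint : ∀ {A : Set} (L : List A) {R y} → Unique (L ++ R) → y ∈ R → y ∉ L
unique-++-disjoint (x ∷ L) (x≢rest ∷ _)  y∈R (here refl) = All.lookup x≢rest (∈-++⁺ʳ L y∈R) refl
unique-++-disjoint (x ∷ L) (_ ∷ unique)   y∈R (there y∈L) = unique-++-disjoint L unique y∈R y∈L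

remove : ∀ {A : Set} {q : A} {R} → q ∈ R → Σ (List A) λ R′ → q ∷ R′ ↭ R
remove {q = q} q∈R with ∈-∃++ q∈R
... | P , Q , refl = P ++ Q , ↭-sym (shift q P Q)

module _ {m : ℕ} (G : SimpleGraph m) where
  open SimpleGraph G using (Adj) renaming (sym to adj-sym)
  open import Data.List.Membership.DecPropositional (_≟_ {n = m}) using (_∈?_)

  -- A growth order: starting from an edge, repeatedly put in front a vertex adjacent to a
  -- vertex already listed.  Read backwards it lists a connected subgraph vertex by vertex.
  data Growth : List (Fin m) → Set where
    edge : ∀ {a b} → Adj a b → Growth (a ∷ b ∷ [])
    grow : ∀ {q d L} → d ∈ L → Adj q d → Growth L → Growth (q ∷ L)

  neighbour-inside : ∀ {L d} → Growth L → d ∈ L → Σ (Fin m) λ c → c ∈ L × Adj c d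
  neighbour-inside (edge {b = b} ab) (here refl)         = b , there (here refl) , adj-sym ab
  neighbour-inside (edge {a = a} ab) (there (here refl)) = a , here refl , ab
  neighbour-inside (grow {d = d} d∈ qd _) (here refl)    = d , there d∈ , adj-sym qd
  neighbour-inside (grow _ _ growth) (there d∈) with neighbour-inside growth d∈
  ... | c , c∈ , cd = c , there c∈ , cd

  WitnessIn : List (Fin m) → (Fin m → ℕ) → ℕ → Set
  WitnessIn L rk t = Σ (Witness G rk t) λ W → let open Witness W in b ∈ L × c ∈ L × d ∈ L

  witness-lift : ∀ r (u w z : Fin m) zs {t} → Unique (u ∷ w ∷ z ∷ zs) →
    WitnessIn (w ∷ z ∷ zs) (spineRank (suc r) w z zs) t → WitnessIn (u ∷ w ∷ z ∷ zs) (spineRank r u w (z ∷ zs)) t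
  witness-lift r u w z zs {t} unique (W , b∈ , c∈ , d∈) =
    record { b = b ; c = c ; d = d
           ; rank-b = trans (tail-rank b∈) rank-b
           ; rank-c = subst (t ℕ.<_) (sym (tail-rank c∈)) rank-c
           ; rank-d = subst (t ℕ.<_) (sym (tail-rank d∈)) rank-d
           ; edge-bd = edge-bd ; edge-cd = edge-cd } ,
    there b∈ , there c∈ , there d∈
    where
    open Witness W
    tail-rank : ∀ {x} → x ∈ w ∷ z ∷ zs → spineRank r u w (z ∷ zs) x ≡ spineRank (suc r) w z zs x
    tail-rank = spineRank-tail-∈ r u w z zs unique

  -- In the caterpillar of a growth order every level t with r ≤ t < r + length zs has a
  -- witness: for t = r take b = u, its later neighbour d given by the growth step, and a later
  -- neighbour c of d given by neighbour-inside; higher levels come from the tail.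
  growth-witness : ∀ r (u w : Fin m) zs → Unique (u ∷ w ∷ zs) → Growth (u ∷ w ∷ zs) →
    ∀ t → r ℕ.≤ t → t ℕ.< r ℕ.+ length zs → WitnessIn (u ∷ w ∷ zs) (spineRank r u w zs) t
  growth-witness r u w [] _ _ t r≤t t<r+0 =
    ⊥-elim (ℕP.<-irrefl refl (ℕP.<-≤-trans t<r+0 (ℕP.≤-trans (ℕP.≤-reflexive (ℕP.+-identityʳ r)) r≤t)))
  growth-witness r u w (z ∷ zs) unique (grow {d = d} d∈ ud growth) t r≤t t<r+ with ℕP.m≤n⇒m<n∨m≡n r≤t
  ... | inj₂ refl with neighbour-inside growth d∈
  ...   | c , c∈ , cd =
    record { b = u ; c = c ; d = d
           ; rank-b = spineRank-head r u w (z ∷ zs)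
           ; rank-c = subst (r ℕ.<_) (sym (spineRank-tail-∈ r u w z zs unique c∈)) (spineRank-≥ (suc r) w z zs c)
           ; rank-d = subst (r ℕ.<_) (sym (spineRank-tail-∈ r u w z zs unique d∈)) (spineRank-≥ (suc r) w z zs d)
           ; edge-bd = ud ; edge-cd = cd } ,
    here refl , there c∈ , there d∈
  growth-witness r u w (z ∷ zs) unique@(_ ∷ unique′) (grow _ _ growth) t r≤t t<r+ | inj₁ r<t =
    witness-lift r u w z zs unique
      (growth-witness (suc r) w z zs unique′ growth t r<t (subst (t ℕ.<_) (ℕP.+-suc r (length zs)) t<r+))

  exit-edge : ∀ L {x y} → x ∈ L → y ∉ L → Reach G x y →
    Σ (Fin m) λ p → Σ (Fin m) λ q → p ∈ L × q ∉ L × Adj p q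
  exit-edge L x∈ y∉ here = ⊥-elim (y∉ x∈)
  exit-edge L {x} x∈ y∉ (there {w = w} xw path) with w ∈? L
  ... | yes w∈ = exit-edge L w∈ y∉ path
  ... | no  w∉ = x , w , x∈ , w∉ , xw

  module _ (connected : Connected G) where

    -- A growth order L whose complement is listed by R extends to a growth order of all
    -- vertices: while R is nonempty, the exit edge towards it supplies the next vertex.
    extend : ∀ n {L} R → length R ≡ n → L ++ R ↭ allFin m → Growth L →
      Σ (List (Fin m)) λ L′ → L′ ↭ allFin m × Growth L′
    extend zero    {L} []      _   perm growth = L , subst (_↭ allFin m) (ListP.++-identityʳ L) perm , growth
    extend (suc n) {a ∷ L} (y ∷ R) len perm growth
      with exit-edge (a ∷ L) (here refl)
             (unique-++-disjoint (a ∷ L) (listing-unique perm) (here refl)) (connected a y)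
    ... | p , q , p∈ , q∉ , pq with ∈-++⁻ (a ∷ L) (listing-complete perm q)
    ...   | inj₁ q∈L = ⊥-elim (q∉ q∈L)
    ...   | inj₂ q∈R with remove q∈R
    ...     | R′ , q∷R′↭R =
      extend n R′ (ℕP.suc-injective (trans (↭-length q∷R′↭R) len))
        (↭-trans (↭-sym (shift q (a ∷ L) R′)) (↭-trans (++⁺ˡ (a ∷ L) q∷R′↭R) perm))
        (grow p∈ (adj-sym pq) growth)

growth-order : ∀ {k} (G : SimpleGraph (suc (suc k))) → Connected G →
  Σ (List (Fin (suc (suc k)))) λ L → L ↭ allFin (suc (suc k)) × Growth G L
growth-order G connected with connected zero (suc zero)
... | there {w = zero}   0~0 _ = ⊥-elim (SimpleGraph.irrefl G zero 0~0)
... | there {w = suc w′} 0~w _ with remove (∈-tabulate⁺ {f = suc} w′)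
...   | R , w∷R↭ = extend G connected (length R) R refl (prep zero w∷R↭) (edge 0~w)

listing-levels : ∀ {m} {u w z : Fin m} {zs} → u ∷ w ∷ z ∷ zs ↭ allFin m → m ∸ 2 ≡ length (z ∷ zs)
listing-levels perm = cong (_∸ 2) (sym (listing-length perm))

caterpillarType : ∀ {m} (u w z : Fin m) zs → u ∷ w ∷ z ∷ zs ↭ allFin m → TopRadType m
caterpillarType {m} u w z zs perm = record
  { left       = leaf u
  ; right      = caterpillar 1 w z zs
  ; rankedL    = tt
  ; rankedR    = ranked-caterpillar 0 1 w z zs (s≤s z≤n)
  ; leavesPerm = subst (λ l → u ∷ l ↭ allFin m) (sym (leaves-caterpillar 1 w z zs)) perm
  ; labelsPerm = ↭-reflexive (begin
      labels (caterpillar 1 w z zs)        ≡⟨ labels-caterpillar 1 w z zs ⟩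
      applyUpTo suc (length (z ∷ zs))      ≡⟨ cong (applyUpTo suc) (sym (listing-levels perm)) ⟩
      applyUpTo suc (m ∸ 2)                ≡⟨ sym (ListP.map-upTo suc (m ∸ 2)) ⟩
      map suc (upTo (m ∸ 2))               ∎)
  }
  where open ≡-Reasoning

caterpillar-full-dim : ∀ {m} (G : SimpleGraph m) (u w z : Fin m) zs (perm : u ∷ w ∷ z ∷ zs ↭ allFin m) →
  Growth G (u ∷ w ∷ z ∷ zs) → ImageFullDim G (caterpillarType u w z zs perm)
caterpillar-full-dim G u w z zs perm growth =
  independence G (caterpillarType u w z zs perm) (spineRank 0 u w (z ∷ zs))
    (λ k → caterpillar-cuts (toℕ k) u w (z ∷ zs) unique (listing-complete perm))
    (λ k → proj₁ (growth-witness G 0 u w (z ∷ zs) unique growth (toℕ k) z≤n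
                    (subst (toℕ k ℕ.<_) (listing-levels perm) (FinP.toℕ<n k))))
  where
  unique : Unique (u ∷ w ∷ z ∷ zs)
  unique = listing-unique perm

lemma3p20 : ∀ (m : ℕ) → 3 ≤ m → (G : SimpleGraph m) → Connected G →
    ∃ λ (T : TopRadType m) → ImageFullDim G T
lemma3p20 (suc zero)          (s≤s ())       _ _
lemma3p20 (suc (suc zero))    (s≤s (s≤s ())) _ _
lemma3p20 (suc (suc (suc k))) _ G connected with growth-order G connected
... | u ∷ w ∷ z ∷ zs , perm , growth = caterpillarType u w z zs perm , caterpillar-full-dim G u w z zs perm growth
... | _ ∷ [] , _ , grow _ _ ()
... | u ∷ w ∷ [] , perm , _ with listing-length perm
...   | ()
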